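{- Let $X$ be a finite set of integers and $k\ge 1$. Let $s_1,\dots,s_k$ be pairwise disjoint APs, each consisting only of elements of $X$, with $s_1\cup\dots\cup s_k=X$. Let $s$ be an AP all of whose elements lie in $X$, and for each $i\in[k]$ let $t_i=s\cap s_i$. Suppose that for some $i$, $t_i$ has at least $k+1$ elements. Then between any two consecutive elements of $t_i$ there are at most $2^{k-1}-1$ elements of $s$.
   Context: An arithmetic progression (AP) is a finite sequence of integers $a, a+d, \dots, a+xd$ with $a,d,x$ integers, $x\ge 0$; it is identified with the set of its elements. $[k]=\{1,\dots,k\}$. -}

module Defs where

open import Data.Nat using (ℕ; suc; _≤_)
open import Data.Integer using (ℤ; +_; _+_; _*_)
open import Data.Fin using (Fin)
open import Data.Product using (Σ; ∃-syntax; _×_)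
open import Relation.Nullary using (¬_)
open import Relation.Binary.PropositionalEquality using (_≡_)
open import Function.Definitions using (Injective)

-- An arithmetic progression a, a+d, ..., a+x*d  (a d : ℤ, x : ℕ),
-- identified with the set of its elements.
record AP : Set where
  constructor mkAP
  field
    start : ℤ
    diff  : ℤ
    len   : ℕ   -- the "x" in a, a+d, ..., a+xd

open AP public

_∈AP_ : ℤ → AP → Set
z ∈AP s = ∃[ j ] (j ≤ len s × z ≡ start s + (+ j) * diff s)

AtLeast : ℕ → (ℤ → Set) → Set
AtLeast n P = Σ (Fin n → ℤ) λ f → Injective _≡_ _≡_ f × (∀ m → P (f m))

AtMost : ℕ → (ℤ → Set) → Set
AtMost n P = ¬ AtLeast (suc n) P

-- WLOG s is increasing; write u = s(U), v = s(V) and n = V − U. Shifting a position of s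
-- on Sᵢ by a multiple of n into [U, V] keeps it on the line of Sᵢ and between two points
-- of Sᵢ, hence in Sᵢ; as u, v are consecutive in tᵢ it lands on U or V, so all positions of
-- tᵢ are ≡ U (mod n). With k + 1 of them we get a window B, B + n, …, B + kn inside tᵢ. For
-- j ≠ i, the offsets in the window of s ∩ Sⱼ are closed under x − y + z up to multiples of
-- n once two of them differ by a multiple of n, so modulo n they form a coset of a
-- subgroup of ℤ/nℤ missing 0; by pigeonhole these k − 1 cosets cover every nonzero
-- residue. Such a cover by m cosets forces n ≤ 2ᵐ: for a prime p with n = pʷ⁺¹r, p ∤ r,
-- the cosets through r, 2r, …, (p − 1)r are distinct and miss pℤ, while the others cover
-- pℤ/nℤ ≅ ℤ/(n/p), so n/p ≤ 2^#others by induction and p ≤ 2^(p−1) ≤ 2^#missing.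
-- Hence at most n − 1 ≤ 2ᵏ⁻¹ − 1 elements of s lie strictly between u and v.

module Submission where

open import Defs
open import Data.Nat using (ℕ; zero; suc; z≤n; s≤s; _^_; _∸_) renaming (_≤_ to _≤ℕ_; _<_ to _<ℕ_)
import Data.Nat as ℕ
import Data.Nat.Properties as ℕ
import Data.Nat.Divisibility as ℕ
open import Data.Nat.Induction using (<-wellFounded)
import Data.Nat.Tactic.RingSolver as ℕ-Solver
open import Data.Nat.Coprimality using (Coprime; coprime-divisor)
open import Data.Nat.GCD using (gcd; gcd-GCD; module Bézout; module GCD)
open import Data.Nat.ListAction using (product)
open import Data.Nat.Primality using (Prime; euclidsLemma; prime⇒irreducible; prime⇒nonTrivial)
open import Data.Nat.Primality.Factorisation using (factorise)
open import Data.Integer using (ℤ; +_; -[1+_]; +[1+_]; 0ℤ; 1ℤ; _+_; _-_; _*_; -_; ∣_∣; +≤+; +<+; _≤_; _<_; Positive; positive; nonNegative)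
import Data.Integer.Properties as ℤ
open import Data.Integer.DivMod using (_/ℕ_; _%ℕ_; a≡a%ℕn+[a/ℕn]*n; n%ℕd<d)
open import Data.Integer.Divisibility.Signed using (_∣_; divides; ∣-refl; ∣ᵤ⇒∣; ∣⇒∣ᵤ; ∣m∣n⇒∣m+n; ∣m∣n⇒∣m-n; ∣m⇒∣-m; ∣n⇒∣m*n)
open import Data.Integer.Tactic.RingSolver using (solve-∀)
open import Data.Fin using (Fin; toℕ; fromℕ<; punchIn; punchOut)
import Data.Fin.Properties as Fin
open import Data.List using (List; []; _∷_; _++_; length; map; tabulate)
open import Data.List.Properties using (length-++; length-map; length-tabulate)
open import Data.List.Membership.Propositional using (_∈_)
open import Data.List.Relation.Unary.All as All using (All; []; _∷_)
import Data.List.Relation.Unary.All.Properties as All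
open import Data.List.Relation.Unary.Any as Any using (Any)
import Data.List.Relation.Unary.Any.Properties as Any
open import Data.List.Relation.Binary.Permutation.Propositional using (_↭_; ↭-prep; ↭-trans; ↭-sym)
open import Data.List.Relation.Binary.Permutation.Propositional.Properties using (Any-resp-↭; All-resp-↭; ↭-length; shift)
open import Data.Product using (∃; ∃₂; ∃-syntax; _×_; _,_; proj₁; proj₂)
open import Data.Sum using (_⊎_; inj₁; inj₂)
open import Data.Empty using (⊥; ⊥-elim)
open import Function.Base using (_∘_)
open import Function.Definitions using (Injective)
open import Induction.WellFounded using (Acc; acc)
open import Relation.Nullary using (¬_; Dec; yes; no)
open import Relation.Nullary.Decidable using (decidable-stable; ¬¬-excluded-middle)
open import Relation.Binary.Definitions using (tri<; tri≈; tri>)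
open import Relation.Binary.PropositionalEquality

-- Nontrivial cosets of subgroups of ℤ/nℤ

record IsNontrivialCoset (n : ℕ) (C : ℤ → Set) : Set where
  field
    periodic : ∀ {x y} → C x → + n ∣ y - x → C y
    affine   : ∀ {x y z} → C x → C y → C z → C (x - y + z)
    0∉       : ¬ C 0ℤ

module _ {n C} (K : IsNontrivialCoset n C) where
  open IsNontrivialCoset K

  coset-+ℕ* : ∀ {x d} → C x → C (x + d) → ∀ l → C (x + + l * d) × C (x - + l * d)
  coset-+ℕ* {x} {d} cx cx+d zero = subst C (x≡x+0*d x d) cx , subst C (x≡x-0*d x d) cx
    where
    x≡x+0*d : ∀ x d → x ≡ x + 0ℤ * d
    x≡x+0*d = solve-∀
    x≡x-0*d : ∀ x d → x ≡ x - 0ℤ * d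
    x≡x-0*d = solve-∀
  coset-+ℕ* {x} {d} cx cx+d (suc l) with coset-+ℕ* cx cx+d l
  ... | up , down = subst C (up-step x d (+ l)) (affine up cx cx+d) , subst C (down-step x d (+ l)) (affine down cx+d cx)
    where
    up-step : ∀ x d l → (x + l * d) - x + (x + d) ≡ x + (1ℤ + l) * d
    up-step = solve-∀
    down-step : ∀ x d l → (x - l * d) - (x + d) + x ≡ x - (1ℤ + l) * d
    down-step = solve-∀

  coset-+* : ∀ {x d} → C x → C (x + d) → ∀ l → C (x + l * d)
  coset-+* cx cx+d (+ l) = proj₁ (coset-+ℕ* cx cx+d l)
  coset-+* {x} {d} cx cx+d -[1+ l ] =
    subst C (x-ld≡x+[-l]d x d (+ suc l)) (proj₂ (coset-+ℕ* cx cx+d (suc l)))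
    where
    x-ld≡x+[-l]d : ∀ x d l → x - l * d ≡ x + (- l) * d
    x-ld≡x+[-l]d = solve-∀

  -- C is invariant under translation by d and by n, so x ∈ dℤ + nℤ would put 0 in C.
  coset-∉-span : ∀ {x d} α β → C x → C (x + d) → x ≢ α * d + β * + n
  coset-∉-span {x} {d} α β cx cx+d refl = 0∉ (periodic (coset-+* cx cx+d (- α)) (divides (- β) (step α d β (+ n))))
    where
    step : ∀ α d β n → 0ℤ - ((α * d + β * n) + (- α) * d) ≡ (- β) * n
    step = solve-∀

pos-+*≡* : ∀ a b c x m → a ℕ.+ b ℕ.* c ≡ x ℕ.* m → + a + + b * + c ≡ + x * + m
pos-+*≡* a b c x m eq = begin
  + a + + b * + c     ≡⟨ cong (_+_ (+ a)) (ℤ.pos-* b c) ⟨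
  + (a ℕ.+ b ℕ.* c)   ≡⟨ cong +_ eq ⟩
  + (x ℕ.* m)         ≡⟨ ℤ.pos-* x m ⟩
  + x * + m           ∎
  where open ≡-Reasoning

bézout : ∀ m n → ∃₂ λ α β → + gcd m n ≡ α * + m + β * + n
bézout m n with Bézout.identity (gcd-GCD m n)
... | Bézout.+- x y eq = + x , - + y , identity
  where
  open ≡-Reasoning
  a≡[a+b]-b : ∀ a b → a ≡ (a + b) - b
  a≡[a+b]-b = solve-∀
  rearrange : ∀ x m y n → x * m - y * n ≡ x * m + - y * n
  rearrange = solve-∀
  identity : + gcd m n ≡ + x * + m + - + y * + n
  identity = begin
    + gcd m n                                ≡⟨ a≡[a+b]-b (+ gcd m n) (+ y * + n) ⟩
    (+ gcd m n + + y * + n) - + y * + n      ≡⟨ cong (_- + y * + n) (pos-+*≡* (gcd m n) y n x m eq) ⟩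
    + x * + m - + y * + n                    ≡⟨ rearrange (+ x) (+ m) (+ y) (+ n) ⟩
    + x * + m + - + y * + n                  ∎
... | Bézout.-+ x y eq = - + x , + y , identity
  where
  open ≡-Reasoning
  a≡[a+b]-b : ∀ a b → a ≡ (a + b) - b
  a≡[a+b]-b = solve-∀
  rearrange : ∀ x m y n → y * n - x * m ≡ - x * m + y * n
  rearrange = solve-∀
  identity : + gcd m n ≡ - + x * + m + + y * + n
  identity = begin
    + gcd m n                                ≡⟨ a≡[a+b]-b (+ gcd m n) (+ x * + m) ⟩
    (+ gcd m n + + x * + m) - + x * + m      ≡⟨ cong (_- + x * + m) (pos-+*≡* (gcd m n) x m y n eq) ⟩
    + y * + n - + x * + m                    ≡⟨ rearrange (+ x) (+ m) (+ y) (+ n) ⟩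
    - + x * + m + + y * + n                  ∎

gcd-∈-span : ∀ d n → ∃₂ λ α β → + gcd ∣ d ∣ n ≡ α * d + β * + n
gcd-∈-span d n with bézout ∣ d ∣ n | ℤ.+∣i∣≡i⊎+∣i∣≡-i d
... | α , β , eq | inj₁ ∣d∣≡d = α , β , trans eq (cong (λ e → α * e + β * + n) ∣d∣≡d)
... | α , β , eq | inj₂ ∣d∣≡-d = - α , β , trans eq (trans (cong (λ e → α * e + β * + n) ∣d∣≡-d) (flip α d (β * + n)))
  where
  flip : ∀ α d b → α * - d + b ≡ - α * d + b
  flip = solve-∀

prime-∤⇒coprime : ∀ {p g} → Prime p → ¬ p ℕ.∣ g → Coprime g p
prime-∤⇒coprime pr p∤g (c∣g , c∣p) with prime⇒irreducible pr c∣p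
... | inj₁ c≡1 = c≡1
... | inj₂ refl = ⊥-elim (p∤g c∣g)

coprime-∣-^* : ∀ {g p r} → Coprime g p → ∀ w → g ℕ.∣ p ^ w ℕ.* r → g ℕ.∣ r
coprime-∣-^* {g} {r = r} _ zero g∣r = subst (g ℕ.∣_) (ℕ.*-identityˡ r) g∣r
coprime-∣-^* {g} {p} {r} cop (suc w) g∣ppʷr =
  coprime-∣-^* cop w (coprime-divisor cop (subst (g ℕ.∣_) (ℕ.*-assoc p (p ^ w) r) g∣ppʷr))

-- gcd(d, n) divides n = pʷ r and is prime to p, hence divides r.
free-part-∈-span : ∀ {p w r} d → Prime p → ¬ + p ∣ d → ∃₂ λ α β → + r ≡ α * d + β * + (p ^ w ℕ.* r)
free-part-∈-span {p} {w} {r} d pr p∤d with gcd-∈-span d (p ^ w ℕ.* r)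
... | α , β , g≡ = + e * α , + e * β , (begin
  + r                                   ≡⟨ cong +_ r≡eg ⟩
  + (e ℕ.* g)                           ≡⟨ ℤ.pos-* e g ⟩
  + e * + g                             ≡⟨ cong (+ e *_) g≡ ⟩
  + e * (α * d + β * + n)               ≡⟨ distrib (+ e) α d β (+ n) ⟩
  + e * α * d + + e * β * + n           ∎)
  where
  open ≡-Reasoning
  n g : ℕ
  n = p ^ w ℕ.* r
  g = gcd ∣ d ∣ n
  g∣d : g ℕ.∣ ∣ d ∣
  g∣d = GCD.GCD.commonDivisor (gcd-GCD ∣ d ∣ n) .proj₁
  g∣r : g ℕ.∣ r
  g∣r = coprime-∣-^* (prime-∤⇒coprime pr (λ p∣g → p∤d (∣ᵤ⇒∣ (ℕ.∣-trans p∣g g∣d)))) w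
          (GCD.GCD.commonDivisor (gcd-GCD ∣ d ∣ n) .proj₂)
  e : ℕ
  e = ℕ._∣_.quotient g∣r
  r≡eg : r ≡ e ℕ.* g
  r≡eg = ℕ._∣_.equality g∣r
  distrib : ∀ e α d β n → e * (α * d + β * n) ≡ e * α * d + e * β * n
  distrib = solve-∀

-- Covers of the nonzero residues by nontrivial cosets

MissesMultiplesOf : ℕ → (ℤ → Set) → Set
MissesMultiplesOf p C = ∀ {y} → + p ∣ y → ¬ C y

onMultiplesOf : ℕ → (ℤ → Set) → ℤ → Set
onMultiplesOf p C y = C (y * + p)

onMultiplesOf-coset : ∀ {n p q C} → n ≡ p ℕ.* q → IsNontrivialCoset n C → IsNontrivialCoset q (onMultiplesOf p C)
onMultiplesOf-coset {n} {p} {q} {C} n≡pq K = record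
  { periodic = λ {x} {y} cx (divides c y-x≡cq) → periodic cx (divides c (begin
      y * + p - x * + p   ≡⟨ factor y x (+ p) ⟩
      (y - x) * + p       ≡⟨ cong (_* + p) y-x≡cq ⟩
      c * + q * + p       ≡⟨ reassoc c (+ q) (+ p) ⟩
      c * (+ p * + q)     ≡⟨ cong (c *_) (trans (cong +_ n≡pq) (ℤ.pos-* p q)) ⟨
      c * + n             ∎))
  ; affine = λ {x} {y} {z} cx cy cz → subst C (factor₃ x y z (+ p)) (affine cx cy cz)
  ; 0∉ = λ c0 → 0∉ (subst C (ℤ.*-zeroˡ (+ p)) c0)
  }
  where
  open IsNontrivialCoset K
  open ≡-Reasoning
  factor : ∀ y x p → y * p - x * p ≡ (y - x) * p
  factor = solve-∀
  factor₃ : ∀ x y z p → x * p - y * p + z * p ≡ (x - y + z) * p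
  factor₃ = solve-∀
  reassoc : ∀ c q p → c * q * p ≡ c * (p * q)
  reassoc = solve-∀

module _ {p r : ℕ} (pr : Prime p) (p∤r : ¬ p ℕ.∣ r) where

  p∤t*r : ∀ {t} → 1 ≤ℕ t → t <ℕ p → ¬ p ℕ.∣ t ℕ.* r
  p∤t*r {t} 1≤t t<p p∣tr with euclidsLemma t r pr p∣tr
  ... | inj₁ p∣t = ℕ.<⇒≱ t<p (ℕ.∣⇒≤ {{ℕ.>-nonZero 1≤t}} p∣t)
  ... | inj₂ p∣r = p∤r p∣r

  r≢0 : r ≢ 0
  r≢0 refl = p∤r (p ℕ.∣0)

  module _ {w C} (K : IsNontrivialCoset (p ^ w ℕ.* r) C) where

    ∤p-step⇒∉rℤ : ∀ {x d} c → C x → C (x + d) → ¬ + p ∣ d → x ≢ c * + r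
    ∤p-step⇒∉rℤ {x} {d} c cx cx+d p∤d x≡cr =
      coset-∉-span K (c * α) (c * β) cx cx+d x≡
      where
      n : ℕ
      n = p ^ w ℕ.* r
      span : ∃₂ λ α β → + r ≡ α * d + β * + n
      span = free-part-∈-span {w = w} d pr p∤d
      α β : ℤ
      α = span .proj₁
      β = span .proj₂ .proj₁
      distrib : ∀ c α d β n → c * (α * d + β * n) ≡ c * α * d + c * β * n
      distrib = solve-∀
      x≡ : x ≡ c * α * d + c * β * + n
      x≡ = trans x≡cr (trans (cong (c *_) (span .proj₂ .proj₂)) (distrib c α d β (+ n)))

    coset-∋t*r⇒misses-multiples : ∀ {t} → 1 ≤ℕ t → t <ℕ p → C (+ (t ℕ.* r)) → MissesMultiplesOf p C
    coset-∋t*r⇒misses-multiples {t} 1≤t t<p ctr {y} p∣y cy =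
      ∤p-step⇒∉rℤ (+ t) ctr (subst C (b≡a+[b-a] (+ (t ℕ.* r)) y) cy) p∤y-tr (ℤ.pos-* t r)
      where
      b≡a+[b-a] : ∀ a b → b ≡ a + (b - a)
      b≡a+[b-a] = solve-∀
      b-[b-a]≡a : ∀ a b → b - (b - a) ≡ a
      b-[b-a]≡a = solve-∀
      p∤y-tr : ¬ + p ∣ y - + (t ℕ.* r)
      p∤y-tr p∣y-tr = p∤t*r 1≤t t<p (∣⇒∣ᵤ (subst (+ p ∣_) (b-[b-a]≡a _ y) (∣m∣n⇒∣m-n p∣y p∣y-tr)))

    coset-∌t*r-and-[t+e]*r : ∀ {t e} → 1 ≤ℕ e → e <ℕ p → C (+ (t ℕ.* r)) → ¬ C (+ ((t ℕ.+ e) ℕ.* r))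
    coset-∌t*r-and-[t+e]*r {t} {e} 1≤e e<p ctr ct+er =
      ∤p-step⇒∉rℤ {d = + (e ℕ.* r)} (+ t) ctr (subst C split ct+er) (λ p∣er → p∤t*r 1≤e e<p (∣⇒∣ᵤ p∣er)) (ℤ.pos-* t r)
      where
      split : + ((t ℕ.+ e) ℕ.* r) ≡ + (t ℕ.* r) + + (e ℕ.* r)
      split = cong +_ (ℕ.*-distribʳ-+ r t e)

¬¬-partition : ∀ {a} {A : Set a} (P : A → Set) (xs : List A)
  → ¬ ¬ (∃₂ λ ys zs → xs ↭ ys ++ zs × All P ys × All (λ x → ¬ P x) zs)
¬¬-partition P [] k = k ([] , [] , _↭_.refl , [] , [])
¬¬-partition P (x ∷ xs) k = ¬¬-partition P xs λ where
  (ys , zs , xs↭ , pys , ¬pzs) → ¬¬-excluded-middle λ where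
    (yes px) → k (x ∷ ys , zs , ↭-prep x xs↭ , px ∷ pys , ¬pzs)
    (no ¬px) → k (ys , x ∷ zs , ↭-trans (↭-prep x xs↭) (↭-sym (shift x ys zs)) , pys , ¬px ∷ ¬pzs)

Covers : ℕ → List (ℤ → Set) → Set₁
Covers n F = ∀ {δ} → 1 ≤ℕ δ → δ <ℕ n → Any (λ C → C (+ δ)) F

suc≤2^ : ∀ m → suc m ≤ℕ 2 ^ m
suc≤2^ zero = s≤s z≤n
suc≤2^ (suc m) = ℕ.+-mono-≤ (ℕ.m^n>0 2 m) (ℕ.≤-trans (suc≤2^ m) (ℕ.m≤m+n (2 ^ m) 0))

module _ {p₀ w r : ℕ} (pr : Prime (suc p₀)) (p∤r : ¬ suc p₀ ℕ.∣ r) where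
  private
    p q n : ℕ
    p = suc p₀
    q = p ^ w ℕ.* r
    n = p ^ suc w ℕ.* r

  n≡p*q : n ≡ p ℕ.* q
  n≡p*q = ℕ.*-assoc p (p ^ w) r

  q<n : q <ℕ n
  q<n = subst (q <ℕ_) (trans (ℕ.*-comm q p) (sym n≡p*q))
          (ℕ.m<m*n q p {{ℕ.m*n≢0 (p ^ w) r {{ℕ.m^n≢0 p w}} {{ℕ.≢-nonZero (r≢0 pr p∤r)}}}} (ℕ.nonTrivial⇒n>1 p {{prime⇒nonTrivial pr}}))

  restricted-cover : ∀ {ys zs} → All (MissesMultiplesOf p) ys → Covers n (ys ++ zs)
    → Covers q (map (onMultiplesOf p) zs)
  restricted-cover {ys} misses cov {δ} 1≤δ δ<q with Any.++⁻ ys (cov 1≤δp δp<n)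
    where
    1≤δp : 1 ≤ℕ δ ℕ.* p
    1≤δp = ℕ.*-mono-≤ 1≤δ (s≤s z≤n)
    δp<n : δ ℕ.* p <ℕ n
    δp<n = subst (δ ℕ.* p <ℕ_) (trans (ℕ.*-comm q p) (sym n≡p*q)) (ℕ.*-monoˡ-< p δ<q)
  ... | inj₁ in-ys = let (misses-C , C∋δp) = All.lookupAny misses in-ys
                     in ⊥-elim (misses-C (divides (+ δ) (ℤ.pos-* δ p)) C∋δp)
  ... | inj₂ in-zs = Any.map⁺ (Any.map (λ {C} → subst C (ℤ.pos-* δ p)) in-zs)

  multiple-of-r : Fin p₀ → ℕ
  multiple-of-r t = suc (toℕ t) ℕ.* r

  1≤multiple-of-r : ∀ t → 1 ≤ℕ multiple-of-r t
  1≤multiple-of-r t = ℕ.*-mono-≤ (s≤s (z≤n {toℕ t})) (ℕ.n≢0⇒n>0 (r≢0 pr p∤r))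

  multiple-of-r<n : ∀ t → multiple-of-r t <ℕ n
  multiple-of-r<n t = ℕ.<-≤-trans (ℕ.*-monoˡ-< r {{ℕ.≢-nonZero (r≢0 pr p∤r)}} (s≤s (Fin.toℕ<n t)))
                                   (ℕ.*-monoˡ-≤ r (ℕ.m≤m*n p (p ^ w) {{ℕ.m^n≢0 p w}}))

  -- The p − 1 numbers t r (0 < t < p) lie in pairwise distinct cosets avoiding pℤ.
  p₀≤length : ∀ {ys zs} → All (IsNontrivialCoset n) ys → All (IsNontrivialCoset n) zs
    → All (λ C → ¬ MissesMultiplesOf p C) zs → Covers n (ys ++ zs) → p₀ ≤ℕ length ys
  p₀≤length {ys} {zs} cosets-ys cosets-zs ¬misses cov = Fin.injective⇒≤ index-injective
    where
    hit : (t : Fin p₀) → Any (λ C → C (+ multiple-of-r t)) ys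
    hit t with Any.++⁻ ys (cov (1≤multiple-of-r t) (multiple-of-r<n t))
    ... | inj₁ in-ys = in-ys
    ... | inj₂ in-zs with All.lookupAny (All.zip (cosets-zs , ¬misses)) in-zs
    ...   | (K , ¬misses-C) , C∋tr = ⊥-elim (¬misses-C (coset-∋t*r⇒misses-multiples pr p∤r {w = suc w} K (s≤s z≤n) (s≤s (Fin.toℕ<n t)) C∋tr))
    index-separated : ∀ {s t} → toℕ s <ℕ toℕ t → Any.index (hit s) ≢ Any.index (hit t)
    index-separated {s} {t} s<t eq = coset-∌t*r-and-[t+e]*r pr p∤r {w = suc w} K {t = suc (toℕ s)} (ℕ.m<n⇒0<n∸m s<t)
      (s≤s (ℕ.≤-trans (ℕ.m∸n≤m (toℕ t) (toℕ s)) (ℕ.<⇒≤ (Fin.toℕ<n t)))) C∋sr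
      (subst (λ m → C (+ (m ℕ.* r))) (sym (cong suc (ℕ.m+[n∸m]≡n (ℕ.<⇒≤ s<t))))
        (subst (λ i → Data.List.lookup ys i (+ multiple-of-r t)) (sym eq) (Any.lookup-result (hit t))))
      where
      C : ℤ → Set
      C = Any.lookup (hit s)
      K : IsNontrivialCoset n C
      K = All.lookupAny cosets-ys (hit s) .proj₁
      C∋sr : C (+ multiple-of-r s)
      C∋sr = All.lookupAny cosets-ys (hit s) .proj₂
    index-injective : ∀ {s t} → Any.index (hit s) ≡ Any.index (hit t) → s ≡ t
    index-injective {s} {t} eq with ℕ.<-cmp (toℕ s) (toℕ t)
    ... | tri< s<t _ _ = ⊥-elim (index-separated s<t eq)
    ... | tri≈ _ s≡t _ = Fin.toℕ-injective s≡t
    ... | tri> _ _ t<s = ⊥-elim (index-separated t<s (sym eq))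

  -- Splitting F by whether a coset misses pℤ is undecidable, but the bound is decidable.
  cover-bound-step : (∀ F → All (IsNontrivialCoset q) F → Covers q F → q ≤ℕ 2 ^ length F)
    → ∀ F → All (IsNontrivialCoset n) F → Covers n F → n ≤ℕ 2 ^ length F
  cover-bound-step bound-q F cosets cov = decidable-stable (n ℕ.≤? 2 ^ length F) λ ¬bound →
    ¬¬-partition (MissesMultiplesOf p) F λ where
      (ys , zs , F↭ , misses , ¬misses) → ¬bound (bound F↭ misses ¬misses)
    where
    bound : ∀ {ys zs} → F ↭ ys ++ zs → All (MissesMultiplesOf p) ys → All (λ C → ¬ MissesMultiplesOf p C) zs
      → n ≤ℕ 2 ^ length F
    bound {ys} {zs} F↭ misses ¬misses = begin
      n                             ≡⟨ n≡p*q ⟩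
      p ℕ.* q                       ≤⟨ ℕ.*-mono-≤ p≤ q≤ ⟩
      2 ^ length ys ℕ.* 2 ^ length zs ≡⟨ ℕ.^-distribˡ-+-* 2 (length ys) (length zs) ⟨
      2 ^ (length ys ℕ.+ length zs) ≡⟨ cong (2 ^_) (trans (sym (length-++ ys)) (sym (↭-length F↭))) ⟩
      2 ^ length F                  ∎
      where
      open ℕ.≤-Reasoning
      cov′ : Covers n (ys ++ zs)
      cov′ 1≤δ δ<n = Any-resp-↭ F↭ (cov 1≤δ δ<n)
      cosets′ : All (IsNontrivialCoset n) ys × All (IsNontrivialCoset n) zs
      cosets′ = All.++⁻ ys (All-resp-↭ F↭ cosets)
      p≤ : p ≤ℕ 2 ^ length ys
      p≤ = ℕ.≤-trans (suc≤2^ p₀) (ℕ.^-monoʳ-≤ 2 (p₀≤length (cosets′ .proj₁) (cosets′ .proj₂) ¬misses cov′))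
      q≤ : q ≤ℕ 2 ^ length zs
      q≤ = subst (λ l → q ≤ℕ 2 ^ l) (length-map (onMultiplesOf p) zs)
             (bound-q _ (All.map⁺ (All.map (onMultiplesOf-coset n≡p*q) (cosets′ .proj₂))) (restricted-cover misses cov′))

prime-factor : ∀ n → 2 ≤ℕ n → ∃ λ p → Prime p × p ℕ.∣ n
prime-factor n@(suc n₀) 2≤n with factorise n
... | record { factors = [] ; isFactorisation = n≡1 } = ⊥-elim (ℕ.<⇒≢ 2≤n (sym n≡1))
... | record { factors = p ∷ ps ; isFactorisation = eq ; factorsPrime = pr ∷ _ } =
  p , pr , ℕ.divides (product ps) (trans eq (ℕ.*-comm p (product ps)))

prime-power-split : ∀ {p} → Prime p → ∀ n → n ≢ 0 → ∃₂ λ w r → n ≡ p ^ w ℕ.* r × ¬ p ℕ.∣ r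
prime-power-split {p} pr n = go n (<-wellFounded n)
  where
  go : ∀ n → Acc _<ℕ_ n → n ≢ 0 → ∃₂ λ w r → n ≡ p ^ w ℕ.* r × ¬ p ℕ.∣ r
  go n (acc rec) n≢0 with p ℕ.∣? n
  ... | no p∤n = 0 , n , sym (ℕ.+-identityʳ n) , p∤n
  ... | yes (ℕ.divides m n≡mp) with go m (rec m<n) m≢0
    where
    m≢0 : m ≢ 0
    m≢0 refl = n≢0 n≡mp
    m<n : m <ℕ n
    m<n = subst (m <ℕ_) (sym n≡mp) (ℕ.m<m*n m p {{ℕ.≢-nonZero m≢0}} (ℕ.nonTrivial⇒n>1 p {{prime⇒nonTrivial pr}}))
  ... | w , r , m≡pʷr , p∤r = suc w , r , trans n≡mp (trans (cong (ℕ._* p) m≡pʷr) (rotate (p ^ w) r p)) , p∤r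
    where
    rotate : ∀ a b c → a ℕ.* b ℕ.* c ≡ c ℕ.* a ℕ.* b
    rotate = ℕ-Solver.solve-∀

cover-bound : ∀ n F → All (IsNontrivialCoset n) F → Covers n F → n ≤ℕ 2 ^ length F
cover-bound n = go n (<-wellFounded n)
  where
  go : ∀ n → Acc _<ℕ_ n → ∀ F → All (IsNontrivialCoset n) F → Covers n F → n ≤ℕ 2 ^ length F
  go 0 _ F _ _ = z≤n
  go 1 _ F _ _ = ℕ.m^n>0 2 (length F)
  go n@(suc (suc _)) (acc rec) F cosets cov with prime-factor n (s≤s (s≤s z≤n))
  ... | suc p₀ , pr , p∣n with prime-power-split pr n (λ ())
  ... | zero , r , n≡r , p∤r = ⊥-elim (p∤r (subst (suc p₀ ℕ.∣_) (trans n≡r (ℕ.*-identityˡ r)) p∣n))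
  ... | suc w , r , n≡pʷr , p∤r =
    subst (λ m → m ≤ℕ 2 ^ length F) (sym n≡pʷr)
      (cover-bound-step {w = w} pr p∤r (go _ (rec (subst (suc p₀ ^ w ℕ.* r <ℕ_) (sym n≡pʷr) (q<n {w = w} pr p∤r))))
        F (subst (λ m → All (IsNontrivialCoset m) F) n≡pʷr cosets) (subst (λ m → Covers m F) n≡pʷr cov))

-- Positions along an arithmetic progression

infix 5 _at_

_at_ : AP → ℤ → ℤ
s at P = start s + P * diff s

+[m∸n]≡+m-+n : ∀ {m n} → n ≤ℕ m → + (m ∸ n) ≡ + m - + n
+[m∸n]≡+m-+n {m} {n} n≤m = trans (sym (ℤ.⊖-≥ n≤m)) (sym (ℤ.m-n≡m⊖n m n))

+-cancelˡ-≤ : ∀ b {x y} → b + x ≤ b + y → x ≤ y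
+-cancelˡ-≤ b {x} {y} le = subst₂ _≤_ (cancel b x) (cancel b y) (ℤ.+-monoʳ-≤ (- b) le)
  where
  cancel : ∀ b x → - b + (b + x) ≡ x
  cancel = solve-∀

in-range⇒∈AP : ∀ {S x} λ' → 0ℤ ≤ λ' → λ' ≤ + len S → x ≡ S at λ' → x ∈AP S
in-range⇒∈AP {S} λ' 0≤λ λ≤L x≡ = ∣ λ' ∣ , ℤ.drop‿+≤+ (subst (_≤ + len S) (sym +∣λ∣≡λ) λ≤L) , trans x≡ (cong (S at_) (sym +∣λ∣≡λ))
  where
  +∣λ∣≡λ : + ∣ λ' ∣ ≡ λ'
  +∣λ∣≡λ = ℤ.0≤i⇒+∣i∣≡i 0≤λ

OnLineOf : AP → ℤ → Set
OnLineOf S z = ∃ λ l → z ≡ S at l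

∈AP⇒OnLineOf : ∀ S {z} → z ∈AP S → OnLineOf S z
∈AP⇒OnLineOf S (j , _ , z≡) = + j , z≡

∈AP-between : ∀ {S x₁ x₂ x} → x₁ ∈AP S → x₂ ∈AP S → x₁ ≤ x → x ≤ x₂ → OnLineOf S x → x ∈AP S
∈AP-between {mkAP b +[1+ e ] L} (l₁ , _ , refl) (l₂ , l₂≤L , refl) x₁≤x x≤x₂ (λ' , refl) =
  in-range⇒∈AP {mkAP b +[1+ e ] L} λ' (ℤ.≤-trans (+≤+ z≤n) (ℤ.*-cancelʳ-≤-pos (+ l₁) λ' +[1+ e ] (+-cancelˡ-≤ b x₁≤x)))
    (ℤ.≤-trans (ℤ.*-cancelʳ-≤-pos λ' (+ l₂) +[1+ e ] (+-cancelˡ-≤ b x≤x₂)) (+≤+ l₂≤L)) refl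
∈AP-between {mkAP b -[1+ e ] L} (l₁ , l₁≤L , refl) (l₂ , _ , refl) x₁≤x x≤x₂ (λ' , refl) =
  in-range⇒∈AP {mkAP b -[1+ e ] L} λ' (ℤ.≤-trans (+≤+ z≤n) (ℤ.*-cancelʳ-≤-neg λ' (+ l₂) -[1+ e ] (+-cancelˡ-≤ b x≤x₂)))
    (ℤ.≤-trans (ℤ.*-cancelʳ-≤-neg (+ l₁) λ' -[1+ e ] (+-cancelˡ-≤ b x₁≤x)) (+≤+ l₁≤L)) refl
∈AP-between {mkAP b (+ 0) L} _ _ _ _ (λ' , refl) = 0 , z≤n , cong (_+_ b) (trans (ℤ.*-zeroʳ λ') (sym (ℤ.*-zeroʳ (+ 0))))

OnLineOf-affine : ∀ s S P₁ P₂ P₃ κ → OnLineOf S (s at P₁) → OnLineOf S (s at P₂) → OnLineOf S (s at P₃)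
  → OnLineOf S (s at P₁ + κ * (P₂ - P₃))
OnLineOf-affine (mkAP a d _) (mkAP b e _) P₁ P₂ P₃ κ (l₁ , E₁) (l₂ , E₂) (l₃ , E₃) = l₁ + κ * (l₂ - l₃) , (begin
  a + (P₁ + κ * (P₂ - P₃)) * d                              ≡⟨ expand a d P₁ P₂ P₃ κ ⟩
  (a + P₁ * d) + κ * ((a + P₂ * d) - (a + P₃ * d))          ≡⟨ cong₂ (λ u v → u + κ * v) E₁ (cong₂ _-_ E₂ E₃) ⟩
  (b + l₁ * e) + κ * ((b + l₂ * e) - (b + l₃ * e))          ≡⟨ expand b e l₁ l₂ l₃ κ ⟨
  b + (l₁ + κ * (l₂ - l₃)) * e                              ∎)
  where
  open ≡-Reasoning
  expand : ∀ a d P₁ P₂ P₃ κ → a + (P₁ + κ * (P₂ - P₃)) * d ≡ (a + P₁ * d) + κ * ((a + P₂ * d) - (a + P₃ * d))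
  expand = solve-∀

injective-into-interval⇒≤ : ∀ {N K} (f : Fin N → ℤ) lo → Injective _≡_ _≡_ f
  → (∀ t → lo ≤ f t) → (∀ t → f t < lo + + K) → N ≤ℕ K
injective-into-interval⇒≤ {N} {K} f lo f-inj lo≤f f<hi = Fin.injective⇒≤ {f = g} g-inj
  where
  +offset : ∀ t → + ∣ f t - lo ∣ ≡ f t - lo
  +offset t = ℤ.0≤i⇒+∣i∣≡i (ℤ.i≤j⇒0≤j-i (lo≤f t))
  [lo+K]-lo≡K : ∀ lo K → (lo + K) - lo ≡ K
  [lo+K]-lo≡K = solve-∀
  offset<K : ∀ t → ∣ f t - lo ∣ <ℕ K
  offset<K t = ℤ.drop‿+<+ (subst₂ _<_ (sym (+offset t)) ([lo+K]-lo≡K lo (+ K)) (ℤ.+-monoˡ-< (- lo) (f<hi t)))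
  g : Fin N → Fin K
  g t = fromℕ< (offset<K t)
  [x-lo]+lo≡x : ∀ x lo → (x - lo) + lo ≡ x
  [x-lo]+lo≡x = solve-∀
  g-inj : Injective _≡_ _≡_ g
  g-inj {t} {t′} gt≡gt′ = f-inj (begin
    f t               ≡⟨ [x-lo]+lo≡x (f t) lo ⟨
    (f t - lo) + lo   ≡⟨ cong (λ m → m + lo) offsets≡ ⟩
    (f t′ - lo) + lo  ≡⟨ [x-lo]+lo≡x (f t′) lo ⟩
    f t′              ∎)
    where
    open ≡-Reasoning
    offsets≡ : f t - lo ≡ f t′ - lo
    offsets≡ = trans (sym (+offset t)) (trans (cong +_ (trans (sym (Fin.toℕ-fromℕ< (offset<K t)))
                 (trans (cong toℕ gt≡gt′) (Fin.toℕ-fromℕ< (offset<K t′))))) (+offset t′))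

argmin : ∀ {N} (f : Fin (suc N) → ℤ) → ∃ λ lo → ∀ t → f lo ≤ f t
argmin {zero} f = Fin.zero , λ { Fin.zero → ℤ.≤-refl }
argmin {suc N} f with argmin (f ∘ Fin.suc)
... | lo , min with f Fin.zero ℤ.≤? f (Fin.suc lo)
...   | yes f0≤ = Fin.zero , λ { Fin.zero → ℤ.≤-refl ; (Fin.suc t) → ℤ.≤-trans f0≤ (min t) }
...   | no f0≰ = Fin.suc lo , λ { Fin.zero → ℤ.<⇒≤ (ℤ.≰⇒> f0≰) ; (Fin.suc t) → min t }

argmax : ∀ {N} (f : Fin (suc N) → ℤ) → ∃ λ hi → ∀ t → f t ≤ f hi
argmax f with argmin (-_ ∘ f)
... | hi , min = hi , λ t → ℤ.neg-cancel-≤ (min t)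

injective⇒spread : ∀ {N} (f : Fin (suc N) → ℤ) → Injective _≡_ _≡_ f → ∃₂ λ lo hi → f lo + + N ≤ f hi
injective⇒spread {N} f f-inj with argmin f | argmax f
... | lo , min | hi , max = lo , hi , ℤ.≤-trans (ℤ.+-monoʳ-≤ (f lo) (+≤+ N≤width)) (ℤ.≤-reflexive (trans (cong (_+_ (f lo)) +width) (lo+[hi-lo]≡hi (f lo) (f hi))))
  where
  +width : + ∣ f hi - f lo ∣ ≡ f hi - f lo
  +width = ℤ.0≤i⇒+∣i∣≡i (ℤ.i≤j⇒0≤j-i (min hi))
  lo+[hi-lo]≡hi : ∀ lo hi → lo + (hi - lo) ≡ hi
  lo+[hi-lo]≡hi = solve-∀
  lo+[1+hi-lo]≡1+hi : ∀ lo hi → lo + (1ℤ + (hi - lo)) ≡ 1ℤ + hi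
  lo+[1+hi-lo]≡1+hi = solve-∀
  N≤width : N ≤ℕ ∣ f hi - f lo ∣
  N≤width = ℕ.≤-pred (injective-into-interval⇒≤ f (f lo) f-inj min λ t →
    ℤ.≤-<-trans (max t) (subst (f hi <_) (sym (trans (cong (λ w → f lo + (1ℤ + w)) +width) (lo+[1+hi-lo]≡1+hi (f lo) (f hi))))
      (ℤ.suc[i]≤j⇒i<j ℤ.≤-refl)))

shift-into-interval : ∀ t {y₁ y₂} → y₁ < y₂ → ∃ λ κ → y₁ ≤ t + κ * (y₁ - y₂) × t + κ * (y₁ - y₂) ≤ y₂
shift-into-interval t {y₁} {y₂} y₁<y₂ = κ , ≤-shifted , shifted-≤
  where
  +D≡ : + ∣ y₂ - y₁ ∣ ≡ y₂ - y₁
  +D≡ = ℤ.0≤i⇒+∣i∣≡i (ℤ.i≤j⇒0≤j-i (ℤ.<⇒≤ y₁<y₂))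
  D : ℕ
  D = ∣ y₂ - y₁ ∣
  instance
    D≢0 : ℕ.NonZero D
    D≢0 = ℕ.≢-nonZero λ D≡0 → ℤ.<-irrefl (sym (ℤ.i-j≡0⇒i≡j y₂ y₁ (trans (sym +D≡) (cong +_ D≡0)))) y₁<y₂
  κ : ℤ
  κ = (t - y₁) /ℕ D
  ρ : ℕ
  ρ = (t - y₁) %ℕ D
  shifted≡ : t + κ * (y₁ - y₂) ≡ y₁ + + ρ
  shifted≡ = begin
    t + κ * (y₁ - y₂)                      ≡⟨ regroup t y₁ y₂ κ ⟩
    y₁ + ((t - y₁) - κ * (y₂ - y₁))        ≡⟨ cong₂ (λ a b → y₁ + (a - κ * b)) (a≡a%ℕn+[a/ℕn]*n (t - y₁) D) (sym +D≡) ⟩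
    y₁ + ((+ ρ + κ * + D) - κ * + D)       ≡⟨ cancel y₁ (+ ρ) (κ * + D) ⟩
    y₁ + + ρ                               ∎
    where
    open ≡-Reasoning
    regroup : ∀ t y₁ y₂ κ → t + κ * (y₁ - y₂) ≡ y₁ + ((t - y₁) - κ * (y₂ - y₁))
    regroup = solve-∀
    cancel : ∀ y ρ e → y + ((ρ + e) - e) ≡ y + ρ
    cancel = solve-∀
  ≤-shifted : y₁ ≤ t + κ * (y₁ - y₂)
  ≤-shifted = subst (y₁ ≤_) (sym shifted≡) (ℤ.i≤i+j y₁ (+ ρ))
  shifted-≤ : t + κ * (y₁ - y₂) ≤ y₂
  shifted-≤ = subst₂ _≤_ (sym shifted≡) (y₁+[y₂-y₁]≡y₂ y₁ y₂)
                (ℤ.+-monoʳ-≤ y₁ (subst (+ ρ ≤_) +D≡ (+≤+ (ℕ.<⇒≤ (n%ℕd<d (t - y₁) D)))))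
    where
    y₁+[y₂-y₁]≡y₂ : ∀ y₁ y₂ → y₁ + (y₂ - y₁) ≡ y₂
    y₁+[y₂-y₁]≡y₂ = solve-∀

module _ (s : AP) .{{_ : Positive (diff s)}} where

  at-mono-< : ∀ {P Q} → P < Q → s at P < s at Q
  at-mono-< = ℤ.+-monoʳ-< (start s) ∘ ℤ.*-monoʳ-<-pos (diff s)

  at-mono-≤ : ∀ {P Q} → P ≤ Q → s at P ≤ s at Q
  at-mono-≤ = ℤ.+-monoʳ-≤ (start s) ∘ ℤ.*-monoʳ-≤-nonNeg (diff s) {{nonNegative (ℤ.<⇒≤ (ℤ.positive⁻¹ (diff s)))}}

  at-cancel-< : ∀ {P Q} → s at P < s at Q → P < Q
  at-cancel-< {P} {Q} sP<sQ with P ℤ.<? Q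
  ... | yes P<Q = P<Q
  ... | no P≮Q = ⊥-elim (ℤ.<⇒≱ sP<sQ (at-mono-≤ (ℤ.≮⇒≥ P≮Q)))

  ∈AP-between-positions : ∀ S {lo hi P} → (s at lo) ∈AP S → (s at hi) ∈AP S → lo ≤ P → P ≤ hi
    → OnLineOf S (s at P) → (s at P) ∈AP S
  ∈AP-between-positions S s-lo s-hi lo≤P P≤hi = ∈AP-between {S} s-lo s-hi (at-mono-≤ lo≤P) (at-mono-≤ P≤hi)

  AtLeast-between⇒≤ : ∀ {U V K} → AtLeast K (λ w → w ∈AP s × (s at + U < w × w < s at + V)) → K ≤ℕ V ∸ U ∸ 1
  AtLeast-between⇒≤ {U} {V} {K} (g , g-inj , g∈) =
    injective-into-interval⇒≤ (λ t → + R t) (+ suc U) (λ R≡ → g-inj (trans (g≡ _) (trans (cong (s at_) R≡) (sym (g≡ _)))))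
      (λ t → ℤ.i<j⇒suc[i]≤j (at-cancel-< {+ U} (subst (s at + U <_) (g≡ t) (g∈ t .proj₂ .proj₁))))
      (λ t → ℤ.<-≤-trans (at-cancel-< {Q = + V} (subst (_< s at + V) (g≡ t) (g∈ t .proj₂ .proj₂))) (+≤+ V≤))
    where
    R : Fin K → ℕ
    R t = g∈ t .proj₁ .proj₁
    g≡ : ∀ t → g t ≡ s at + R t
    g≡ t = g∈ t .proj₁ .proj₂ .proj₂
    V≤ : V ≤ℕ suc U ℕ.+ (V ∸ U ∸ 1)
    V≤ = subst (λ k → V ≤ℕ suc U ℕ.+ k) (sym (ℕ.∸-+-assoc V U 1)) (subst (λ k → V ≤ℕ suc U ℕ.+ (V ∸ k)) (ℕ.+-comm 1 U) (ℕ.m≤n+m∸n V (suc U)))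

reverseAP : AP → AP
reverseAP s = mkAP (s at + len s) (- diff s) (len s)

∈AP-reverse⁺ : ∀ s {z} → z ∈AP s → z ∈AP reverseAP s
∈AP-reverse⁺ (mkAP a d L) (j , j≤L , refl) =
  L ∸ j , ℕ.m∸n≤m L j , trans (flip a d (+ L) (+ j)) (cong (λ k → (a + + L * d) + k * - d) (sym (+[m∸n]≡+m-+n j≤L)))
  where
  flip : ∀ a d L j → a + j * d ≡ (a + L * d) + (L - j) * - d
  flip = solve-∀

∈AP-reverse⁻ : ∀ s {z} → z ∈AP reverseAP s → z ∈AP s
∈AP-reverse⁻ (mkAP a d L) (j , j≤L , refl) =
  L ∸ j , ℕ.m∸n≤m L j , trans (flip a d (+ L) (+ j)) (cong (λ k → a + k * d) (sym (+[m∸n]≡+m-+n j≤L)))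
  where
  flip : ∀ a d L j → (a + L * d) + j * - d ≡ a + (L - j) * d
  flip = solve-∀

∈AP-constant : ∀ a {L z} → z ∈AP mkAP a 0ℤ L → z ≡ a
∈AP-constant a (j , _ , refl) = trans (cong (_+_ a) (ℤ.*-zeroʳ (+ j))) (ℤ.+-identityʳ a)

-- Cosets traced on a window

Recurs : ℕ → (ℤ → Set) → Set
Recurs n J = ∃₂ λ y₁ y₂ → J y₁ × J y₂ × y₁ < y₂ × + n ∣ y₂ - y₁

AffineMod : ℕ → (ℤ → Set) → Set
AffineMod n J = ∀ {y₁ y₂ x y z} → J y₁ → J y₂ → y₁ < y₂ → + n ∣ y₂ - y₁ → J x → J y → J z
  → ∃ λ w → J w × + n ∣ w - (x - y + z)

-- The Recurs conjunct supplies the period that AffineMod needs for closure under x − y + z.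
residuesOf : ℕ → (ℤ → Set) → ℤ → Set
residuesOf n J x = Recurs n J × ∃ λ w → J w × + n ∣ x - w

residuesOf-coset : ∀ {n J} → AffineMod n J → (∀ {x} → J x → ¬ + n ∣ x) → IsNontrivialCoset n (residuesOf n J)
residuesOf-coset {n} {J} affine no-multiple = record
  { periodic = λ {x} {y} (rec , w , Jw , n∣x-w) n∣y-x →
      rec , w , Jw , subst (+ n ∣_) (telescope y x w) (∣m∣n⇒∣m+n n∣y-x n∣x-w)
  ; affine = λ {x} {y} {z} (rec@(_ , _ , J₁ , J₂ , y₁<y₂ , n∣y₂-y₁) , wx , Jx , n∣x) (_ , wy , Jy , n∣y) (_ , wz , Jz , n∣z) →
      let (w , Jw , n∣w) = affine J₁ J₂ y₁<y₂ n∣y₂-y₁ Jx Jy Jz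
      in rec , w , Jw , subst (+ n ∣_) (regroup x y z wx wy wz w) (∣m∣n⇒∣m-n (∣m∣n⇒∣m+n (∣m∣n⇒∣m-n n∣x n∣y) n∣z) n∣w)
  ; 0∉ = λ (_ , w , Jw , n∣0-w) → no-multiple Jw (subst (+ n ∣_) (neg-0-w w) (∣m⇒∣-m n∣0-w))
  }
  where
  telescope : ∀ y x w → (y - x) + (x - w) ≡ y - w
  telescope = solve-∀
  regroup : ∀ x y z wx wy wz w → ((x - wx) - (y - wy) + (z - wz)) - (w - (wx - wy + wz)) ≡ (x - y + z) - w
  regroup = solve-∀
  neg-0-w : ∀ w → - (0ℤ - w) ≡ w
  neg-0-w = solve-∀

-- By pigeonhole, some Jⱼ contains two of qn + δ (q ≤ m): it recurs and meets the residue of δ.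
window-cover-bound : ∀ n m (J : Fin m → ℤ → Set) → (∀ j → AffineMod n (J j)) → (∀ j {x} → J j x → ¬ + n ∣ x)
  → (∀ {q δ} → q ≤ℕ m → 1 ≤ℕ δ → δ <ℕ n → ∃ λ j → J j (+ (q ℕ.* n ℕ.+ δ)))
  → n ≤ℕ 2 ^ m
window-cover-bound n m J affine no-multiple covers =
  subst (λ l → n ≤ℕ 2 ^ l) (length-tabulate (residuesOf n ∘ J))
    (cover-bound n _ (All.tabulate⁺ λ j → residuesOf-coset (affine j) (no-multiple j)) cov)
  where
  cov : Covers n (tabulate (residuesOf n ∘ J))
  cov {δ} 1≤δ δ<n with Fin.pigeonhole (ℕ.n<1+n m) (λ q → proj₁ (covers (ℕ.≤-pred (Fin.toℕ<n q)) 1≤δ δ<n))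
  ... | q₁ , q₂ , q₁<q₂ , same-j = Any.tabulate⁺ j (rec , y q₁ , J∋y₁ , divides (- + toℕ q₁) (δ-y (toℕ q₁)))
    where
    y : Fin (suc m) → ℤ
    y q = + (toℕ q ℕ.* n ℕ.+ δ)
    hit : ∀ q → ∃ λ j → J j (y q)
    hit q = covers (ℕ.≤-pred (Fin.toℕ<n q)) 1≤δ δ<n
    j : Fin m
    j = proj₁ (hit q₁)
    J∋y₁ : J j (y q₁)
    J∋y₁ = proj₂ (hit q₁)
    J∋y₂ : J j (y q₂)
    J∋y₂ = subst (λ j′ → J j′ (y q₂)) (sym same-j) (proj₂ (hit q₂))
    +y : ∀ a → + (a ℕ.* n ℕ.+ δ) ≡ + a * + n + + δ
    +y a = cong (_+ + δ) (ℤ.pos-* a n)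
    δ-y : ∀ a → + δ - + (a ℕ.* n ℕ.+ δ) ≡ - + a * + n
    δ-y a = trans (cong (λ t → + δ - t) (+y a)) (cancel (+ a) (+ n) (+ δ))
      where
      cancel : ∀ a n δ → δ - (a * n + δ) ≡ - a * n
      cancel = solve-∀
    y₂-y₁ : y q₂ - y q₁ ≡ (+ toℕ q₂ - + toℕ q₁) * + n
    y₂-y₁ = trans (cong₂ _-_ (+y (toℕ q₂)) (+y (toℕ q₁))) (difference (+ toℕ q₁) (+ toℕ q₂) (+ n) (+ δ))
      where
      difference : ∀ a b n δ → (b * n + δ) - (a * n + δ) ≡ (b - a) * n
      difference = solve-∀
    rec : Recurs n (J j)
    rec = y q₁ , y q₂ , J∋y₁ , J∋y₂
        , +<+ (ℕ.+-monoˡ-< δ (ℕ.*-monoˡ-< n {{ℕ.>-nonZero (ℕ.<-≤-trans 1≤δ (ℕ.<⇒≤ δ<n))}} q₁<q₂))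
        , divides (+ toℕ q₂ - + toℕ q₁) y₂-y₁

-- The gap between consecutive elements of tᵢ

module Ascending
  {m : ℕ} (S : Fin (suc m) → AP)
  (disjoint : ∀ i j → i ≢ j → ∀ z → z ∈AP S i → z ∈AP S j → ⊥)
  {X : List ℤ} (X⊆⋃S : ∀ z → z ∈ X → ∃[ i ] (z ∈AP S i))
  (s : AP) {{_ : Positive (diff s)}} (s⊆X : ∀ z → z ∈AP s → z ∈ X)
  (i : Fin (suc m)) {u v : ℤ} (u∈ : u ∈AP s × u ∈AP S i) (v∈ : v ∈AP s × v ∈AP S i) (u<v : u < v)
  (consecutive : ∀ w → (w ∈AP s × w ∈AP S i) → u < w → w < v → ⊥)
  where

  U V : ℕ
  U = u∈ .proj₁ .proj₁
  V = v∈ .proj₁ .proj₁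

  u≡ : u ≡ s at + U
  u≡ = u∈ .proj₁ .proj₂ .proj₂

  v≡ : v ≡ s at + V
  v≡ = v∈ .proj₁ .proj₂ .proj₂

  sU∈Sᵢ : (s at + U) ∈AP S i
  sU∈Sᵢ = subst (_∈AP S i) u≡ (u∈ .proj₂)

  sV∈Sᵢ : (s at + V) ∈AP S i
  sV∈Sᵢ = subst (_∈AP S i) v≡ (v∈ .proj₂)

  U<V : U <ℕ V
  U<V = ℤ.drop‿+<+ (at-cancel-< s (subst₂ _<_ u≡ v≡ u<v))

  n : ℕ
  n = V ∸ U

  n∣V-U : + n ∣ + V - + U
  n∣V-U = subst (+ n ∣_) (+[m∸n]≡+m-+n (ℕ.<⇒≤ U<V)) ∣-refl

  at∈s : ∀ {P} → 0ℤ ≤ P → P ≤ + len s → (s at P) ∈AP s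
  at∈s {P} 0≤P P≤L = in-range⇒∈AP {s} P 0≤P P≤L refl

  between⇒endpoint : ∀ {W} → + U ≤ W → W ≤ + V → (s at W) ∈AP S i → W ≡ + U ⊎ W ≡ + V
  between⇒endpoint {W} U≤W W≤V sW∈Sᵢ with ℤ.<-cmp (+ U) W | ℤ.<-cmp W (+ V)
  ... | tri≈ _ U≡W _ | _ = inj₁ (sym U≡W)
  ... | _ | tri≈ _ W≡V _ = inj₂ W≡V
  ... | tri> _ _ W<U | _ = ⊥-elim (ℤ.<⇒≱ W<U U≤W)
  ... | _ | tri> _ _ V<W = ⊥-elim (ℤ.<⇒≱ V<W W≤V)
  ... | tri< U<W _ _ | tri< W<V _ _ = ⊥-elim (
    consecutive _ (at∈s (ℤ.≤-trans (+≤+ z≤n) U≤W) (ℤ.≤-trans W≤V (+≤+ (v∈ .proj₁ .proj₂ .proj₁))) , sW∈Sᵢ)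
      (subst (_< s at W) (sym u≡) (at-mono-< s U<W)) (subst (s at W <_) (sym v≡) (at-mono-< s W<V)))

  endpoint⇒n∣W-U : ∀ {W} → W ≡ + U ⊎ W ≡ + V → + n ∣ W - + U
  endpoint⇒n∣W-U (inj₁ refl) = divides 0ℤ (ℤ.+-inverseʳ (+ U))
  endpoint⇒n∣W-U (inj₂ refl) = n∣V-U

  n∣U-V : + n ∣ + U - + V
  n∣U-V = subst (+ n ∣_) (neg-flip (+ V) (+ U)) (∣m⇒∣-m n∣V-U)
    where
    neg-flip : ∀ V U → - (V - U) ≡ U - V
    neg-flip = solve-∀

  ∈Sᵢ⇒n∣P-U : ∀ P → (s at P) ∈AP S i → + n ∣ P - + U
  ∈Sᵢ⇒n∣P-U P sP∈Sᵢ = subst (+ n ∣_) (P-U≡ P κ (+ U) (+ V)) (∣m∣n⇒∣m-n n∣W-U (∣n⇒∣m*n κ n∣U-V))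
    where
    shifted : ∃ λ κ → + U ≤ P + κ * (+ U - + V) × P + κ * (+ U - + V) ≤ + V
    shifted = shift-into-interval P (+<+ U<V)
    κ W : ℤ
    κ = shifted .proj₁
    W = P + κ * (+ U - + V)
    P-U≡ : ∀ P κ U V → (P + κ * (U - V) - U) - κ * (U - V) ≡ P - U
    P-U≡ = solve-∀
    sW∈Sᵢ : (s at W) ∈AP S i
    sW∈Sᵢ = ∈AP-between-positions s (S i) sU∈Sᵢ sV∈Sᵢ (shifted .proj₂ .proj₁) (shifted .proj₂ .proj₂)
              (OnLineOf-affine s (S i) P (+ U) (+ V) κ (∈AP⇒OnLineOf (S i) sP∈Sᵢ) (∈AP⇒OnLineOf (S i) sU∈Sᵢ) (∈AP⇒OnLineOf (S i) sV∈Sᵢ))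
    n∣W-U : + n ∣ W - + U
    n∣W-U = endpoint⇒n∣W-U (between⇒endpoint (shifted .proj₂ .proj₁) (shifted .proj₂ .proj₂) sW∈Sᵢ)

  instance
    n-positive : Positive (+ n)
    n-positive = positive (+<+ (ℕ.m<n⇒0<n∸m U<V))

  record Window : Set where
    field
      B           : ℤ
      0≤B         : 0ℤ ≤ B
      end≤len     : B + + suc m * + n ≤ + len s
      n∣B-U       : + n ∣ B - + U
      lattice∈Sᵢ  : ∀ {c} → 0ℤ ≤ c → c ≤ + suc m → (s at B + c * + n) ∈AP S i

  module _ {f : Fin (suc (suc m)) → ℤ} (f∈ : ∀ t → f t ∈AP s × f t ∈AP S i) where

    private
      Pos : Fin (suc (suc m)) → ℕ
      Pos t = f∈ t .proj₁ .proj₁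

      sPos∈Sᵢ : ∀ t → (s at + Pos t) ∈AP S i
      sPos∈Sᵢ t = subst (_∈AP S i) (f∈ t .proj₁ .proj₂ .proj₂) (f∈ t .proj₂)

      n∣Pos-U : ∀ t → + n ∣ + Pos t - + U
      n∣Pos-U t = ∈Sᵢ⇒n∣P-U (+ Pos t) (sPos∈Sᵢ t)

    quotientOf : Fin (suc (suc m)) → ℤ
    quotientOf t = _∣_.quotient (n∣Pos-U t)

    Pos≡ : ∀ t → + Pos t ≡ + U + quotientOf t * + n
    Pos≡ t = trans (x≡u+[x-u] (+ Pos t) (+ U)) (cong (_+_ (+ U)) (_∣_.equality (n∣Pos-U t)))
      where
      x≡u+[x-u] : ∀ x u → x ≡ u + (x - u)
      x≡u+[x-u] = solve-∀

    quotientOf-injective : Injective _≡_ _≡_ f → Injective _≡_ _≡_ quotientOf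
    quotientOf-injective f-inj {t} {t′} Q≡ = f-inj (trans (f∈ t .proj₁ .proj₂ .proj₂) (trans (cong (s at_) Pos-eq) (sym (f∈ t′ .proj₁ .proj₂ .proj₂))))
      where
      Pos-eq : + Pos t ≡ + Pos t′
      Pos-eq = trans (Pos≡ t) (trans (cong (λ q → + U + q * + n) Q≡) (sym (Pos≡ t′)))

    window-between : ∀ lo hi → quotientOf lo + + suc m ≤ quotientOf hi → Window
    window-between lo hi spread = record
      { B = + Pos lo
      ; 0≤B = +≤+ z≤n
      ; end≤len = ℤ.≤-trans end≤hi (+≤+ (f∈ hi .proj₁ .proj₂ .proj₁))
      ; n∣B-U = n∣Pos-U lo
      ; lattice∈Sᵢ = lattice∈Sᵢ
      }
      where
      end≤hi : + Pos lo + + suc m * + n ≤ + Pos hi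
      end≤hi = begin
        + Pos lo + + suc m * + n                  ≡⟨ cong (_+ + suc m * + n) (Pos≡ lo) ⟩
        + U + quotientOf lo * + n + + suc m * + n ≡⟨ regroup (+ U) (quotientOf lo) (+ suc m) (+ n) ⟩
        + U + (quotientOf lo + + suc m) * + n     ≤⟨ ℤ.+-monoʳ-≤ (+ U) (ℤ.*-monoʳ-≤-nonNeg (+ n) spread) ⟩
        + U + quotientOf hi * + n                 ≡⟨ Pos≡ hi ⟨
        + Pos hi                                  ∎
        where
        open ℤ.≤-Reasoning
        regroup : ∀ u q k n → u + q * n + k * n ≡ u + (q + k) * n
        regroup = solve-∀
      lattice∈Sᵢ : ∀ {c} → 0ℤ ≤ c → c ≤ + suc m → (s at + Pos lo + c * + n) ∈AP S i
      lattice∈Sᵢ {c} 0≤c c≤ = ∈AP-between-positions s (S i) (sPos∈Sᵢ lo) (sPos∈Sᵢ hi)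
        (ℤ.i≤i+j (+ Pos lo) (c * + n) {{nonNegative (ℤ.*-monoʳ-≤-nonNeg (+ n) 0≤c)}})
        (ℤ.≤-trans (ℤ.+-monoʳ-≤ (+ Pos lo) (ℤ.*-monoʳ-≤-nonNeg (+ n) c≤)) end≤hi)
        (subst (OnLineOf (S i) ∘ (s at_)) position≡
          (OnLineOf-affine s (S i) (+ U) (+ V) (+ U) (quotientOf lo + c)
            (∈AP⇒OnLineOf (S i) sU∈Sᵢ) (∈AP⇒OnLineOf (S i) sV∈Sᵢ) (∈AP⇒OnLineOf (S i) sU∈Sᵢ)))
        where
        regroup : ∀ u q c n → u + (q + c) * n ≡ u + q * n + c * n
        regroup = solve-∀
        position≡ : + U + (quotientOf lo + c) * (+ V - + U) ≡ + Pos lo + c * + n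
        position≡ = trans (cong (λ d → + U + (quotientOf lo + c) * d) (sym (+[m∸n]≡+m-+n (ℕ.<⇒≤ U<V))))
                      (trans (regroup (+ U) (quotientOf lo) c (+ n)) (cong (_+ c * + n) (sym (Pos≡ lo))))

  window : AtLeast (suc (suc m)) (λ z → z ∈AP s × z ∈AP S i) → Window
  window (f , f-inj , f∈) =
    let lo , hi , spread = injective⇒spread (quotientOf f∈) (quotientOf-injective f∈ f-inj)
    in window-between f∈ lo hi spread

  module _ (win : Window) where
    open Window win

    InWindowOf : Fin m → ℤ → Set
    InWindowOf j x = 0ℤ ≤ x × x ≤ + suc m * + n × (s at B + x) ∈AP S (punchIn i j)

    InWindowOf-no-multiple : ∀ j {x} → InWindowOf j x → ¬ + n ∣ x
    InWindowOf-no-multiple j (0≤x , x≤ , sBx∈Sⱼ) (divides c refl) =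
      disjoint i (punchIn i j) (λ i≡ → Fin.punchInᵢ≢i i j (sym i≡)) _
        (lattice∈Sᵢ (ℤ.*-cancelʳ-≤-pos 0ℤ c (+ n) 0≤x) (ℤ.*-cancelʳ-≤-pos c (+ suc m) (+ n) x≤)) sBx∈Sⱼ

    InWindowOf-covers : ∀ {q δ} → q ≤ℕ m → 1 ≤ℕ δ → δ <ℕ n → ∃ λ j → InWindowOf j (+ (q ℕ.* n ℕ.+ δ))
    InWindowOf-covers {q} {δ} q≤m 1≤δ δ<n = pick (X⊆⋃S _ (s⊆X _ sBx∈s))
      where
      x : ℤ
      x = + (q ℕ.* n ℕ.+ δ)
      x≤ : x ≤ + suc m * + n
      x≤ = subst (x ≤_) (ℤ.pos-* (suc m) n) (+≤+ (ℕ.≤-trans (ℕ.<⇒≤ (ℕ.+-monoʳ-< (q ℕ.* n) δ<n))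
             (subst (ℕ._≤ suc m ℕ.* n) (ℕ.+-comm n (q ℕ.* n)) (ℕ.*-monoˡ-≤ n (s≤s q≤m)))))
      sBx∈s : (s at B + x) ∈AP s
      sBx∈s = at∈s (ℤ.≤-trans 0≤B (ℤ.i≤i+j B x)) (ℤ.≤-trans (ℤ.+-monoʳ-≤ B x≤) end≤len)
      ¬n∣x : ¬ + n ∣ x
      ¬n∣x n∣x = ℕ.<⇒≱ δ<n (ℕ.∣⇒≤ {{ℕ.>-nonZero 1≤δ}} (∣⇒∣ᵤ n∣δ))
        where
        [a+b]-a≡b : ∀ a b → (a + b) - a ≡ b
        [a+b]-a≡b = solve-∀
        n∣δ : + n ∣ + δ
        n∣δ = subst (+ n ∣_) ([a+b]-a≡b (+ (q ℕ.* n)) (+ δ)) (∣m∣n⇒∣m-n n∣x (divides (+ q) (ℤ.pos-* q n)))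
      [B+x-U]-[B-U]≡x : ∀ B x U → (B + x - U) - (B - U) ≡ x
      [B+x-U]-[B-U]≡x = solve-∀
      pick : ∃[ j′ ] (s at B + x) ∈AP S j′ → ∃ λ j → InWindowOf j x
      pick (j′ , sBx∈Sⱼ′) = choose (i Fin.≟ j′)
        where
        choose : Dec (i ≡ j′) → ∃ λ j → InWindowOf j x
        choose (yes refl) = ⊥-elim (¬n∣x (subst (+ n ∣_) ([B+x-U]-[B-U]≡x B x (+ U))
                              (∣m∣n⇒∣m-n (∈Sᵢ⇒n∣P-U (B + x) sBx∈Sⱼ′) n∣B-U)))
        choose (no i≢j′) = punchOut i≢j′ , +≤+ z≤n , x≤
                         , subst (λ j → (s at B + x) ∈AP S j) (sym (Fin.punchIn-punchOut i≢j′)) sBx∈Sⱼ′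

    InWindowOf-affine : ∀ j → AffineMod n (InWindowOf j)
    InWindowOf-affine j {y₁} {y₂} {x} {y} {z} (0≤y₁ , _ , sy₁∈) (_ , y₂≤ , sy₂∈) y₁<y₂ n∣y₂-y₁ (_ , _ , sx∈) (_ , _ , sy∈) (_ , _ , sz∈) =
      w , (ℤ.≤-trans 0≤y₁ y₁≤w , ℤ.≤-trans w≤y₂ y₂≤ , sw∈) , n∣w-t
      where
      Sⱼ : AP
      Sⱼ = S (punchIn i j)
      t : ℤ
      t = x - y + z
      shifted : ∃ λ κ → y₁ ≤ t + κ * (y₁ - y₂) × t + κ * (y₁ - y₂) ≤ y₂
      shifted = shift-into-interval t y₁<y₂
      κ w : ℤ
      κ = shifted .proj₁
      w = t + κ * (y₁ - y₂)
      y₁≤w : y₁ ≤ w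
      y₁≤w = shifted .proj₂ .proj₁
      w≤y₂ : w ≤ y₂
      w≤y₂ = shifted .proj₂ .proj₂
      Bx+[Bz-By] : ℤ
      Bx+[Bz-By] = B + x + 1ℤ * ((B + z) - (B + y))
      online : OnLineOf Sⱼ (s at Bx+[Bz-By] + κ * ((B + y₁) - (B + y₂)))
      online = OnLineOf-affine s Sⱼ Bx+[Bz-By] (B + y₁) (B + y₂) κ
                 (OnLineOf-affine s Sⱼ (B + x) (B + z) (B + y) 1ℤ
                   (∈AP⇒OnLineOf Sⱼ sx∈) (∈AP⇒OnLineOf Sⱼ sz∈) (∈AP⇒OnLineOf Sⱼ sy∈))
                 (∈AP⇒OnLineOf Sⱼ sy₁∈) (∈AP⇒OnLineOf Sⱼ sy₂∈)
      position≡ : ∀ B x y z y₁ y₂ κ → B + x + 1ℤ * ((B + z) - (B + y)) + κ * ((B + y₁) - (B + y₂))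
                                      ≡ B + (x - y + z + κ * (y₁ - y₂))
      position≡ = solve-∀
      sw∈ : (s at B + w) ∈AP Sⱼ
      sw∈ = ∈AP-between-positions s Sⱼ sy₁∈ sy₂∈ (ℤ.+-monoʳ-≤ B y₁≤w) (ℤ.+-monoʳ-≤ B w≤y₂)
              (subst (OnLineOf Sⱼ ∘ (s at_)) (position≡ B x y z y₁ y₂ κ) online)
      w-t≡ : ∀ t κ d → (t + κ * d) - t ≡ κ * d
      w-t≡ = solve-∀
      neg-flip : ∀ y₂ y₁ → - (y₂ - y₁) ≡ y₁ - y₂
      neg-flip = solve-∀
      n∣w-t : + n ∣ w - t
      n∣w-t = subst (+ n ∣_) (sym (w-t≡ t κ (y₁ - y₂))) (∣n⇒∣m*n κ (subst (+ n ∣_) (neg-flip y₂ y₁) (∣m⇒∣-m n∣y₂-y₁)))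

    gap≤2^m : n ≤ℕ 2 ^ m
    gap≤2^m = window-cover-bound n m InWindowOf InWindowOf-affine InWindowOf-no-multiple InWindowOf-covers

  strictly-between≤2^m-1 : AtLeast (suc (suc m)) (λ z → z ∈AP s × z ∈AP S i)
    → AtMost (2 ^ m ∸ 1) (λ w → w ∈AP s × (u < w × w < v))
  strictly-between≤2^m-1 many (g , g-inj , g∈) =
    ℕ.<-irrefl refl (ℕ.≤-trans count (ℕ.∸-monoˡ-≤ 1 (gap≤2^m (window many))))
    where
    count : suc (2 ^ m ∸ 1) ≤ℕ n ∸ 1
    count = AtLeast-between⇒≤ s {U} {V} (g , g-inj , λ t → g∈ t .proj₁ , subst (_< g t) u≡ (g∈ t .proj₂ .proj₁)
                                                               , subst (g t <_) v≡ (g∈ t .proj₂ .proj₂))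

lemma2 : (X : List ℤ) (k : ℕ) → 1 ≤ℕ k → (S : Fin k → AP)
    → (∀ i j → i ≢ j → ∀ z → z ∈AP S i → z ∈AP S j → ⊥)
    → (∀ i z → z ∈AP S i → z ∈ X)
    → (∀ z → z ∈ X → ∃[ i ] (z ∈AP S i))
    → (s : AP)
    → (∀ z → z ∈AP s → z ∈ X)
    → (i : Fin k)
    → AtLeast (suc k) (λ z → z ∈AP s × z ∈AP S i)
    → (u v : ℤ) → (u ∈AP s × u ∈AP S i) → (v ∈AP s × v ∈AP S i) → u < v
    → (∀ w → (w ∈AP s × w ∈AP S i) → u < w → w < v → ⊥)
    → AtMost (2 ^ (k ∸ 1) ∸ 1) (λ w → w ∈AP s × (u < w × w < v))
lemma2 X (suc m) _ S disjoint _ X⊆⋃S s@(mkAP _ +[1+ _ ] _) s⊆X i many u v u∈ v∈ u<v consecutive =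
  Ascending.strictly-between≤2^m-1 S disjoint X⊆⋃S s s⊆X i u∈ v∈ u<v consecutive many
lemma2 X (suc m) _ S disjoint _ X⊆⋃S (mkAP a (+ 0) _) s⊆X i many u v u∈ v∈ u<v consecutive =
  ⊥-elim (ℤ.<-irrefl (trans (∈AP-constant a (u∈ .proj₁)) (sym (∈AP-constant a (v∈ .proj₁)))) u<v)
lemma2 X (suc m) _ S disjoint _ X⊆⋃S s@(mkAP _ -[1+ _ ] _) s⊆X i (f , f-inj , f∈) u v u∈ v∈ u<v consecutive (g , g-inj , g∈) =
  Ascending.strictly-between≤2^m-1 S disjoint X⊆⋃S (reverseAP s) (λ z → s⊆X z ∘ ∈AP-reverse⁻ s) i
    (reversed u∈) (reversed v∈) u<v (λ w → consecutive w ∘ unreversed)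
    (f , f-inj , reversed ∘ f∈) (g , g-inj , λ t → ∈AP-reverse⁺ s (g∈ t .proj₁) , g∈ t .proj₂)
  where
  reversed : ∀ {z T} → z ∈AP s × T → z ∈AP reverseAP s × T
  reversed (z∈s , t) = ∈AP-reverse⁺ s z∈s , t
  unreversed : ∀ {z T} → z ∈AP reverseAP s × T → z ∈AP s × T
  unreversed (z∈s′ , t) = ∈AP-reverse⁻ s z∈s′ , t
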